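{- Let $\varphi$ be a sentence as in the context. Then $\varphi$ belongs to GAF (axiomatic definition) if and only if (I) every atom in $\psi$ contains at most one variable from $\vec{x}$, and (II) for all distinct $x,x'\in\vec{x}$ with $\mathrm{idx}(x)\le\mathrm{idx}(x')$ and every $y\in\bigcup_{i\ge\mathrm{idx}(x)}\vec{y}_i$ it holds $y\notin\mathrm{vars}(\mathcal{L}_x)\cap\mathrm{vars}(\mathcal{L}_{x'})$.
   Context: Let $\varphi := \forall \vec{x}_1 \exists \vec{y}_1 \ldots \forall \vec{x}_n \exists \vec{y}_n.\,\psi$ be a sentence in standard form ($\vec{x}_i,\vec{y}_i$ tuples of variables, $\vec{x}_1$, $\vec{y}_n$ possibly empty; $\psi$ quantifier-free, in negation normal form, using only $\wedge,\vee,\neg$; every prefix variable occurs in $\psi$; no variable bound twice) without equality and without non-constant function symbols. Let $\vec{x}:=\bigcup_i\vec{x}_i$, $\vec{y}:=\bigcup_i\vec{y}_i$, $\mathrm{At}$ the set of atoms of $\varphi$, $\mathrm{vars}(S)$ the set of variables in a set $S$ of atoms or literals, and $\mathrm{idx}(v):=k$ iff $v\in\vec{x}_k$ or $v\in\vec{y}_k$. Axiomatic definition: $\varphi$ belongs to GAF iff $\mathrm{At}$ can be partitioned into sets $\mathrm{At}_0$ and $\mathrm{At}_x$, $x\in\vec{x}$, such that (a) $\mathrm{vars}(\mathrm{At}_0)\cap\vec{x}=\emptyset$; (b) for every $x\in\vec{x}$, $\mathrm{vars}(\mathrm{At}_x)\cap\vec{x}=\{x\}$; (c) for every $y\in\vec{y}$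 occurring in some $\mathrm{At}_x$, exactly one of: (c.1) for every $\mathrm{At}_x$ in which $y$ occurs, $\mathrm{idx}(y)<\mathrm{idx}(x)$; or (c.2) there is exactly one $\mathrm{At}_x$ in which $y$ occurs, $y$ does not occur in $\mathrm{At}_0$, and $\mathrm{idx}(y)\ge\mathrm{idx}(x)$. Let $\mathcal{G}_\varphi$ be the directed graph with vertex set $\vec{y}$ and an edge $\langle y,y'\rangle$ iff $\mathrm{idx}(y)\le\mathrm{idx}(y')$ and some atom of $\psi$ contains both $y$ and $y'$. For $y\in\vec{y}$, the upward closure $\Cup_y$ is the smallest subset of $\vec{y}$ containing $y$ and closed under following edges of $\mathcal{G}_\varphi$; $\mathcal{L}(\Cup_y)$ is the set of literals of $\psi$ containing a variable from $\Cup_y$. For $x\in\vec{x}$, $\mathcal{L}_x$ is the smallest set of literals such that (a') every literal of $\psi$ in which $x$ occurs belongs to $\mathcal{L}_x$, and (b') for every $y\in\mathrm{vars}(\mathcal{L}_x)\cap\vec{y}$ with $\mathrm{idx}(y)\ge\mathrm{idx}(x)$ we have $\mathcal{L}(\Cup_y)\subseteq\mathcal{L}_x$. -}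

module Defs where

open import Data.Nat using (ℕ; zero; suc; _≤_; _<_)
open import Data.Bool using (Bool; true; false)
open import Data.List using (List; []; _∷_; _++_; concatMap)
open import Data.List.Membership.Propositional using (_∈_)
open import Data.List.Relation.Unary.Unique.Propositional using (Unique)
open import Data.Maybe using (Maybe; just; nothing)
open import Data.Product using (Σ; _×_; _,_; ∃; ∃-syntax)
open import Data.Sum using (_⊎_)
open import Data.Unit using (⊤)
open import Relation.Nullary using (¬_)
open import Relation.Binary.PropositionalEquality using (_≡_; _≢_)

data Term : Set where
  var   : ℕ → Term
  const : ℕ → Term

record Atom : Set where
  constructor atom
  field
    pred : ℕ
    args : List Term
open Atom public

-- A literal: polarity (true = positive, false = negated) and atom.
Literal : Set
Literal = Bool × Atom

litAtom : Literal → Atom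
litAtom (_ , a) = a

-- Quantifier-free formulas in negation normal form over ∧, ∨, ¬
-- (negation only in front of atoms, i.e. inside literals).
data NNF : Set where
  lit  : Literal → NNF
  _∧'_ : NNF → NNF → NNF
  _∨'_ : NNF → NNF → NNF

-- One quantifier block ∀ xs ∃ ys.
record Block : Set where
  constructor block
  field
    xs : List ℕ
    ys : List ℕ
open Block public

-- φ = ∀x₁∃y₁ … ∀xₙ∃yₙ. ψ ; block k of the list (0-based) is block k+1.
record Sentence : Set where
  constructor sentence
  field
    prefix : List Block
    matrix : NNF
open Sentence public

data LitOf : NNF → Literal → Set where
  here  : ∀ {l} → LitOf (lit l) l
  ∧ˡ    : ∀ {ψ χ l} → LitOf ψ l → LitOf (ψ ∧' χ) l
  ∧ʳ    : ∀ {ψ χ l} → LitOf χ l → LitOf (ψ ∧' χ) l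
  ∨ˡ    : ∀ {ψ χ l} → LitOf ψ l → LitOf (ψ ∨' χ) l
  ∨ʳ    : ∀ {ψ χ l} → LitOf χ l → LitOf (ψ ∨' χ) l

AtomOf : Sentence → Atom → Set
AtomOf φ a = ∃[ b ] LitOf (matrix φ) (b , a)

VarInAtom : ℕ → Atom → Set
VarInAtom v a = var v ∈ args a

VarInLit : ℕ → Literal → Set
VarInLit v l = VarInAtom v (litAtom l)

VarInNNF : ℕ → NNF → Set
VarInNNF v ψ = ∃[ l ] (LitOf ψ l × VarInLit v l)

VarsAtoms : (Atom → Set) → ℕ → Set
VarsAtoms S v = ∃[ a ] (S a × VarInAtom v a)

VarsLits : (Literal → Set) → ℕ → Set
VarsLits S v = ∃[ l ] (S l × VarInLit v l)

-- XAt bs v k : v ∈ x⃗_{k+1};  YAt bs v k : v ∈ y⃗_{k+1}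
data XAt : List Block → ℕ → ℕ → Set where
  here  : ∀ {b bs v} → v ∈ xs b → XAt (b ∷ bs) v zero
  there : ∀ {b bs v k} → XAt bs v k → XAt (b ∷ bs) v (suc k)

data YAt : List Block → ℕ → ℕ → Set where
  here  : ∀ {b bs v} → v ∈ ys b → YAt (b ∷ bs) v zero
  there : ∀ {b bs v k} → YAt bs v k → YAt (b ∷ bs) v (suc k)

IsX : Sentence → ℕ → Set
IsX φ v = ∃[ k ] XAt (prefix φ) v k

IsY : Sentence → ℕ → Set
IsY φ v = ∃[ k ] YAt (prefix φ) v k

-- idx(v) = k (0-based block number; only comparisons are used)
Idx : Sentence → ℕ → ℕ → Set
Idx φ v k = XAt (prefix φ) v k ⊎ YAt (prefix φ) v k

IdxLt : Sentence → ℕ → ℕ → Set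
IdxLt φ v w = ∃[ k ] ∃[ k' ] (Idx φ v k × Idx φ w k' × k < k')

IdxLe : Sentence → ℕ → ℕ → Set
IdxLe φ v w = ∃[ k ] ∃[ k' ] (Idx φ v k × Idx φ w k' × k ≤ k')

blockVars : Block → List ℕ
blockVars b = xs b ++ ys b

-- x⃗₁ and y⃗ₙ may be empty, all other blocks are non-empty
Shape : Bool → List Block → Set
Shape first [] = ⊤
Shape first (b ∷ []) = first ≡ true ⊎ xs b ≢ []
Shape first (b ∷ b' ∷ bs) =
  (first ≡ true ⊎ xs b ≢ []) × ys b ≢ [] × Shape false (b' ∷ bs)

record StandardForm (φ : Sentence) : Set where
  field
    shape       : Shape true (prefix φ)
    noRebinding : Unique (concatMap blockVars (prefix φ))
    prefixUsed  : ∀ v → (IsX φ v ⊎ IsY φ v) → VarInNNF v (matrix φ)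
    closed      : ∀ v → VarInNNF v (matrix φ) → IsX φ v ⊎ IsY φ v

-- GAF, axiomatic definition.
-- A partition of At into At₀ and At_x (x ∈ x⃗) is given by a labelling
-- f : Atom → Maybe ℕ : a ∈ At₀ iff f a ≡ nothing, a ∈ At_x iff f a ≡ just x.

module _ (φ : Sentence) (f : Atom → Maybe ℕ) where

  At₀ : Atom → Set
  At₀ a = AtomOf φ a × f a ≡ nothing

  At[_] : ℕ → Atom → Set
  At[ x ] a = AtomOf φ a × f a ≡ just x

  LabelsOK : Set
  LabelsOK = ∀ a x → AtomOf φ a → f a ≡ just x → IsX φ x

  CondA : Set
  CondA = ∀ v → VarsAtoms At₀ v → ¬ IsX φ v

  CondB : Set
  CondB = ∀ x → IsX φ x →
            VarsAtoms At[ x ] x ×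
            (∀ v → VarsAtoms At[ x ] v → IsX φ v → v ≡ x)

  C1 : ℕ → Set
  C1 y = ∀ x → IsX φ x → VarsAtoms At[ x ] y → IdxLt φ y x

  C2 : ℕ → Set
  C2 y = ∃[ x ] (IsX φ x × VarsAtoms At[ x ] y
                × (∀ x' → IsX φ x' → VarsAtoms At[ x' ] y → x' ≡ x)
                × ¬ VarsAtoms At₀ y
                × IdxLe φ x y)

  CondC : Set
  CondC = ∀ y → IsY φ y → (∃[ x ] (IsX φ x × VarsAtoms At[ x ] y)) →
            (C1 y ⊎ C2 y) × ¬ (C1 y × C2 y)

GAF : Sentence → Set
GAF φ = ∃[ f ] (LabelsOK φ f × CondA φ f × CondB φ f × CondC φ f)

Edge : Sentence → ℕ → ℕ → Set
Edge φ y y' = IsY φ y × IsY φ y' × IdxLe φ y y'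
            × ∃[ a ] (AtomOf φ a × VarInAtom y a × VarInAtom y' a)

data Up (φ : Sentence) (y : ℕ) : ℕ → Set where
  base : IsY φ y → Up φ y y
  step : ∀ {z z'} → Up φ y z → Edge φ z z' → Up φ y z'

LUp : Sentence → ℕ → Literal → Set
LUp φ y l = LitOf (matrix φ) l × ∃[ v ] (Up φ y v × VarInLit v l)

data LX (φ : Sentence) (x : ℕ) : Literal → Set where
  init  : ∀ {l} → LitOf (matrix φ) l → VarInLit x l → LX φ x l
  close : ∀ {y l'} → VarsLits (LX φ x) y → IsY φ y → IdxLe φ x y →
          LUp φ y l' → LX φ x l'

CondI : Sentence → Set
CondI φ = ∀ a → AtomOf φ a → ∀ v w → VarInAtom v a → VarInAtom w a →
          IsX φ v → IsX φ w → v ≡ w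

CondII : Sentence → Set
CondII φ = ∀ x x' → IsX φ x → IsX φ x' → x ≢ x' → IdxLe φ x x' →
           ∀ y → IsY φ y → IdxLe φ x y →
           ¬ (VarsLits (LX φ x) y × VarsLits (LX φ x') y)

-- Forward: an atom containing some x ∈ x⃗ must lie in At_x.  A variable y occurring in At_x
-- with idx(y) ≥ idx(x) cannot satisfy (c.1), so by (c.2) every atom containing y lies in At_x;
-- this propagates along 𝒢_φ, hence every literal of 𝓛_x lies in At_x, which gives (I) and (II).
-- Backward: 𝓛_x is generated from x by passing through literals to variables y with
-- idx(y) ≥ idx(x).  Put an atom into At_x when one of its variables is reached from x this way;
-- (I) and (II) make such an x unique, and reachability in the finite variable graph is decidable,
-- so this is a partition, and it satisfies (a)–(c).
module Submission where

open import Defs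
open import Data.Empty using (⊥; ⊥-elim)
open import Data.List using (List; []; _∷_; _++_; concatMap; length)
open import Data.List.Membership.Propositional using (_∈_; find; lose)
open import Data.List.Membership.Propositional.Properties using (∈-++⁺ˡ; ∈-++⁺ʳ; ∈-++⁻; ∈-∃++)
import Data.List.Membership.DecPropositional as DecMembership
open import Data.List.Relation.Unary.All as All using (All; []; _∷_)
open import Data.List.Relation.Unary.Any using (here; there; any?)
open import Data.List.Relation.Unary.Unique.Propositional using (Unique)
open import Data.List.Relation.Unary.AllPairs using (_∷_)
open import Data.Maybe using (Maybe; just; nothing)
open import Data.Maybe.Properties using (just-injective)
open import Data.Nat using (ℕ; zero; suc; _≤_; _<_; s≤s; _≤?_)
open import Data.Nat.Induction using (<-wellFounded)
open import Data.Nat.Properties using (≤-refl; ≤-trans; ≤-total; ≤⇒≯; ≰⇒>)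
import Data.Nat.Properties as ℕ
open import Data.Product using (_×_; _,_; ∃-syntax; proj₁; proj₂)
open import Data.Sum using (_⊎_; inj₁; inj₂; [_,_])
open import Function using (_∘_)
open import Function.Bundles using (_⇔_; mk⇔)
open import Induction.WellFounded using (Acc; acc)
open import Relation.Binary.Definitions using (Decidable; DecidableEquality)
open import Relation.Binary.Construct.Closure.ReflexiveTransitive using (Star; ε; _◅_; _◅◅_)
open import Relation.Binary.PropositionalEquality using (_≡_; _≢_; refl; sym; trans; cong; subst)
open import Relation.Nullary using (¬_; Dec; yes; no)
open import Relation.Nullary.Decidable using (map′; _×-dec_; _⊎-dec_)
import Relation.Unary as Unary

unique-++-disjoint : ∀ {A : Set} (xs : List A) {ys v} → Unique (xs ++ ys) → v ∈ xs → v ∈ ys → ⊥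
unique-++-disjoint (_ ∷ xs) (x≢ ∷ _) (here refl) v∈ys = All.lookup x≢ (∈-++⁺ʳ xs v∈ys) refl
unique-++-disjoint (_ ∷ xs) (_ ∷ u) (there v∈xs) v∈ys = unique-++-disjoint xs u v∈xs v∈ys

unique-++⁻ʳ : ∀ {A : Set} (xs : List A) {ys} → Unique (xs ++ ys) → Unique ys
unique-++⁻ʳ [] u = u
unique-++⁻ʳ (_ ∷ xs) (_ ∷ u) = unique-++⁻ʳ xs u

length-++-∷ : ∀ {A : Set} (pre : List A) {w} post → length (pre ++ post) < length (pre ++ w ∷ post)
length-++-∷ [] post = ≤-refl
length-++-∷ (_ ∷ pre) post = s≤s (length-++-∷ pre post)

module FiniteReachability {A : Set} (_≟_ : DecidableEquality A)
  {_⟶_ : A → A → Set} (_⟶?_ : Decidable _⟶_)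
  (U : List A) (⟶-target-in-U : ∀ {v w} → v ⟶ w → w ∈ U) where

  open DecMembership _≟_ using (_∈?_)

  Closed : List A → Set
  Closed V = ∀ {v w} → v ∈ V → v ⟶ w → w ∈ V

  star-closed : ∀ {V v w} → Closed V → v ∈ V → Star _⟶_ v w → w ∈ V
  star-closed closed v∈V ε = v∈V
  star-closed closed v∈V (s ◅ ss) = star-closed closed (closed v∈V s) ss

  explore : ∀ {s} V R → Acc _<_ (length R) → s ∈ V → All (Star _⟶_ s) V →
            (∀ {w} → w ∈ U → w ∈ V ⊎ w ∈ R) →
            ∃[ V' ] (s ∈ V' × All (Star _⟶_ s) V' × Closed V')
  explore V R (acc rec) s∈V reached covered
    with any? (λ w → any? (λ v → v ⟶? w) V) R
  ... | no unreachable = V , s∈V , reached , closed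
    where
    closed : Closed V
    closed v∈V v⟶w with covered (⟶-target-in-U v⟶w)
    ... | inj₁ w∈V = w∈V
    ... | inj₂ w∈R = ⊥-elim (unreachable (lose w∈R (lose v∈V v⟶w)))
  ... | yes found
    with w , w∈R , from-V ← find found
    with v , v∈V , v⟶w ← find from-V
    with pre , post , refl ← ∈-∃++ w∈R
    = explore (w ∷ V) (pre ++ post) (rec (length-++-∷ pre post)) (there s∈V)
              ((All.lookup reached v∈V ◅◅ (v⟶w ◅ ε)) ∷ reached) covered′
    where
    covered′ : ∀ {u} → u ∈ U → u ∈ w ∷ V ⊎ u ∈ pre ++ post
    covered′ u∈U with covered u∈U
    ... | inj₁ u∈V = inj₁ (there u∈V)
    ... | inj₂ u∈R with ∈-++⁻ pre u∈R
    ...   | inj₁ u∈pre = inj₂ (∈-++⁺ˡ u∈pre)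
    ...   | inj₂ (here u≡w) = inj₁ (here u≡w)
    ...   | inj₂ (there u∈post) = inj₂ (∈-++⁺ʳ pre u∈post)

  star? : Decidable (Star _⟶_)
  star? s t with V , s∈V , reached , closed ← explore (s ∷ []) U (<-wellFounded _) (here refl) (ε ∷ []) inj₂
    = map′ (All.lookup reached) (star-closed closed s∈V) (t ∈? V)

_≟ᵀ_ : DecidableEquality Term
var m ≟ᵀ var n = map′ (cong var) (λ { refl → refl }) (m ℕ.≟ n)
var _ ≟ᵀ const _ = no λ ()
const _ ≟ᵀ var _ = no λ ()
const m ≟ᵀ const n = map′ (cong const) (λ { refl → refl }) (m ℕ.≟ n)

varInLit? : ∀ v l → Dec (VarInLit v l)
varInLit? v l = var v ∈ᵀ? args (litAtom l)
  where open DecMembership _≟ᵀ_ renaming (_∈?_ to _∈ᵀ?_)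

anyLit? : ∀ {P : Literal → Set} → Unary.Decidable P → ∀ ψ → Dec (∃[ l ] (LitOf ψ l × P l))
anyLit? P? (lit l) = map′ (λ p → l , here , p) (λ { (_ , here , p) → p }) (P? l)
anyLit? P? (ψ ∧' χ) = map′
  [ (λ (l , o , p) → l , ∧ˡ o , p) , (λ (l , o , p) → l , ∧ʳ o , p) ]
  (λ { (l , ∧ˡ o , p) → inj₁ (l , o , p) ; (l , ∧ʳ o , p) → inj₂ (l , o , p) })
  (anyLit? P? ψ ⊎-dec anyLit? P? χ)
anyLit? P? (ψ ∨' χ) = map′
  [ (λ (l , o , p) → l , ∨ˡ o , p) , (λ (l , o , p) → l , ∨ʳ o , p) ]
  (λ { (l , ∨ˡ o , p) → inj₁ (l , o , p) ; (l , ∨ʳ o , p) → inj₂ (l , o , p) })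
  (anyLit? P? ψ ⊎-dec anyLit? P? χ)

anyVar? : ∀ {P : ℕ → Set} → Unary.Decidable P → ∀ ts → Dec (∃[ v ] (var v ∈ ts × P v))
anyVar? P? [] = no λ { (_ , () , _) }
anyVar? P? (const _ ∷ ts) = map′
  (λ (v , m , p) → v , there m , p)
  (λ { (v , there m , p) → v , m , p })
  (anyVar? P? ts)
anyVar? P? (var u ∷ ts) = map′
  [ (λ p → u , here refl , p) , (λ (v , m , p) → v , there m , p) ]
  (λ { (_ , here refl , p) → inj₁ p ; (v , there m , p) → inj₂ (v , m , p) })
  (P? u ⊎-dec anyVar? P? ts)

anyYAt? : ∀ {P : ℕ → Set} → Unary.Decidable P → ∀ bs w → Dec (∃[ k ] (YAt bs w k × P k))
anyYAt? P? [] w = no λ { (_ , () , _) }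
anyYAt? P? (b ∷ bs) w = map′
  [ (λ (m , p) → zero , here m , p) , (λ (k , y , p) → suc k , there y , p) ]
  (λ { (zero , here m , p) → inj₁ (m , p) ; (suc k , there y , p) → inj₂ (k , y , p) })
  ((w ∈? ys b ×-dec P? zero) ⊎-dec anyYAt? (P? ∘ suc) bs w)
  where open DecMembership ℕ._≟_ using (_∈?_)

anyXAt? : ∀ {Q : ℕ → ℕ → Set} → (∀ x k → Dec (Q x k)) →
          ∀ bs → Dec (∃[ x ] ∃[ k ] (XAt bs x k × Q x k))
anyXAt? Q? [] = no λ { (_ , _ , () , _) }
anyXAt? Q? (b ∷ bs) = map′
  [ (λ p → let x , m , q = find p in x , zero , here m , q)
  , (λ (x , k , xat , q) → x , suc k , there xat , q) ]
  (λ { (_ , zero , here m , q) → inj₁ (lose m q) ; (x , suc k , there xat , q) → inj₂ (x , k , xat , q) })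
  (any? (λ x → Q? x zero) (xs b) ⊎-dec anyXAt? (λ x k → Q? x (suc k)) bs)

IdxAt : List Block → ℕ → ℕ → Set
IdxAt bs v k = XAt bs v k ⊎ YAt bs v k

idxAt-bound : ∀ {bs v k} → IdxAt bs v k → v ∈ concatMap blockVars bs
idxAt-bound {b ∷ _} (inj₁ (here m)) = ∈-++⁺ˡ (∈-++⁺ˡ m)
idxAt-bound {b ∷ _} (inj₂ (here m)) = ∈-++⁺ˡ (∈-++⁺ʳ (xs b) m)
idxAt-bound {b ∷ _} (inj₁ (there p)) = ∈-++⁺ʳ (blockVars b) (idxAt-bound (inj₁ p))
idxAt-bound {b ∷ _} (inj₂ (there p)) = ∈-++⁺ʳ (blockVars b) (idxAt-bound (inj₂ p))

idxAt-zero : ∀ {b bs v} → IdxAt (b ∷ bs) v zero → v ∈ blockVars b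
idxAt-zero (inj₁ (here m)) = ∈-++⁺ˡ m
idxAt-zero {b} (inj₂ (here m)) = ∈-++⁺ʳ (xs b) m

idxAt-suc : ∀ {b bs v k} → IdxAt (b ∷ bs) v (suc k) → IdxAt bs v k
idxAt-suc (inj₁ (there p)) = inj₁ p
idxAt-suc (inj₂ (there p)) = inj₂ p

idxAt-unique : ∀ bs {v k k'} → Unique (concatMap blockVars bs) →
               IdxAt bs v k → IdxAt bs v k' → k ≡ k'
idxAt-unique [] _ (inj₁ ()) _
idxAt-unique [] _ (inj₂ ()) _
idxAt-unique (b ∷ bs) {k = zero} {zero} u p q = refl
idxAt-unique (b ∷ bs) {k = zero} {suc _} u p q =
  ⊥-elim (unique-++-disjoint (blockVars b) u (idxAt-zero p) (idxAt-bound (idxAt-suc q)))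
idxAt-unique (b ∷ bs) {k = suc _} {zero} u p q =
  ⊥-elim (unique-++-disjoint (blockVars b) u (idxAt-zero q) (idxAt-bound (idxAt-suc p)))
idxAt-unique (b ∷ bs) {k = suc _} {suc _} u p q =
  cong suc (idxAt-unique bs (unique-++⁻ʳ (blockVars b) u) (idxAt-suc p) (idxAt-suc q))

module Indices (φ : Sentence) (sf : StandardForm φ) where

  idx-unique : ∀ {v k k'} → Idx φ v k → Idx φ v k' → k ≡ k'
  idx-unique = idxAt-unique (prefix φ) (StandardForm.noRebinding sf)

  idxLe-trans : ∀ {u v w} → IdxLe φ u v → IdxLe φ v w → IdxLe φ u w
  idxLe-trans (k₁ , k₂ , p₁ , p₂ , k₁≤k₂) (k₃ , k₄ , p₃ , p₄ , k₃≤k₄) =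
    k₁ , k₄ , p₁ , p₄ , ≤-trans k₁≤k₂ (subst (_≤ k₄) (idx-unique p₃ p₂) k₃≤k₄)

  idxLe⇒¬idxLt : ∀ {u v} → IdxLe φ u v → ¬ IdxLt φ v u
  idxLe⇒¬idxLt (k₁ , k₂ , p₁ , p₂ , k₁≤k₂) (k₃ , k₄ , p₃ , p₄ , k₃<k₄)
    rewrite idx-unique p₃ p₂ | idx-unique p₄ p₁ = ≤⇒≯ k₁≤k₂ k₃<k₄

  C1-C2-exclusive : ∀ f y → ¬ (C1 φ f y × C2 φ f y)
  C1-C2-exclusive f y (c1 , (x , x∈x⃗ , y∈Atₓ , _ , _ , x≤y)) = idxLe⇒¬idxLt x≤y (c1 x x∈x⃗ y∈Atₓ)

LX-literal : ∀ {φ x l} → LX φ x l → LitOf (matrix φ) l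
LX-literal (init o _) = o
LX-literal (close _ _ _ (o , _)) = o

module GAF⇒Conditions (φ : Sentence) (sf : StandardForm φ) (f : Atom → Maybe ℕ)
  (labels : LabelsOK φ f) (condA : CondA φ f) (condB : CondB φ f) (condC : CondC φ f) where
  open Indices φ sf

  label-of-x : ∀ {a v} → AtomOf φ a → VarInAtom v a → IsX φ v → f a ≡ just v
  label-of-x {a} {v} a∈At v∈a v∈x⃗ with f a in eq
  ... | nothing = ⊥-elim (condA v (a , (a∈At , eq) , v∈a) v∈x⃗)
  ... | just x = cong just (sym (proj₂ (condB x (labels a x a∈At eq)) v (a , (a∈At , eq) , v∈a) v∈x⃗))

  condI : CondI φ
  condI a a∈At v w v∈a w∈a v∈x⃗ w∈x⃗ =
    just-injective (trans (sym (label-of-x a∈At v∈a v∈x⃗)) (label-of-x a∈At w∈a w∈x⃗))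

  LateIn : ℕ → ℕ → Set
  LateIn x y = IsY φ y × IdxLe φ x y × VarsAtoms (At[_] φ f x) y

  -- A late y cannot satisfy (c.1), so by (c.2) At_x is the only part it meets.
  late-label : ∀ {x y a} → IsX φ x → LateIn x y → AtomOf φ a → VarInAtom y a → f a ≡ just x
  late-label {x} {y} {a} x∈x⃗ (y∈y⃗ , x≤y , y∈Atₓ) a∈At y∈a
    with proj₁ (condC y y∈y⃗ (x , x∈x⃗ , y∈Atₓ)) | f a in eq
  ... | inj₁ c1 | _ = ⊥-elim (idxLe⇒¬idxLt x≤y (c1 x x∈x⃗ y∈Atₓ))
  ... | inj₂ (_ , _ , _ , _ , y∉At₀ , _) | nothing = ⊥-elim (y∉At₀ (a , (a∈At , eq) , y∈a))
  ... | inj₂ (_ , _ , _ , sole , _ , _) | just x' =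
    cong just (trans (sole x' (labels a x' a∈At eq) (a , (a∈At , eq) , y∈a)) (sym (sole x x∈x⃗ y∈Atₓ)))

  late-upward : ∀ {x y z} → IsX φ x → LateIn x y → Up φ y z → LateIn x z
  late-upward x∈x⃗ late (base _) = late
  late-upward x∈x⃗ late (step up (_ , z'∈y⃗ , z≤z' , a , a∈At , z∈a , z'∈a)) =
    z'∈y⃗ , idxLe-trans x≤z z≤z' , (a , (a∈At , late-label x∈x⃗ late-z a∈At z∈a) , z'∈a)
    where
    late-z = late-upward x∈x⃗ late up
    x≤z = proj₁ (proj₂ late-z)

  vars-LX⊆vars-Atₓ : ∀ {x l v} → IsX φ x → LX φ x l → VarInLit v l → VarsAtoms (At[_] φ f x) v
  LX⊆Atₓ : ∀ {x l} → IsX φ x → LX φ x l → f (litAtom l) ≡ just x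
  LX⊆Atₓ x∈x⃗ (init o x∈l) = label-of-x (_ , o) x∈l x∈x⃗
  LX⊆Atₓ x∈x⃗ (close (_ , l₀∈𝓛ₓ , y∈l₀) y∈y⃗ x≤y (o , _ , up , z∈l)) =
    late-label x∈x⃗ (late-upward x∈x⃗ (y∈y⃗ , x≤y , vars-LX⊆vars-Atₓ x∈x⃗ l₀∈𝓛ₓ y∈l₀) up) (_ , o) z∈l

  vars-LX⊆vars-Atₓ x∈x⃗ l∈𝓛ₓ v∈l = _ , ((_ , LX-literal l∈𝓛ₓ) , LX⊆Atₓ x∈x⃗ l∈𝓛ₓ) , v∈l

  condII : CondII φ
  condII x x' x∈x⃗ x'∈x⃗ x≢x' _ y y∈y⃗ x≤y ((l , l∈𝓛ₓ , y∈l) , (l' , l'∈𝓛ₓ' , y∈l')) =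
    x≢x' (just-injective (trans (sym (late-label x∈x⃗ late (_ , LX-literal l'∈𝓛ₓ') y∈l'))
                                (LX⊆Atₓ x'∈x⃗ l'∈𝓛ₓ')))
    where
    late : LateIn x y
    late = y∈y⃗ , x≤y , vars-LX⊆vars-Atₓ x∈x⃗ l∈𝓛ₓ y∈l

nothing≢just : ∀ {A : Set} {x : A} → nothing ≢ just x
nothing≢just ()

module Conditions⇒GAF (φ : Sentence) (sf : StandardForm φ) (condI : CondI φ) (condII : CondII φ) where
  open Indices φ sf

  YFrom : ℕ → ℕ → Set
  YFrom k y = ∃[ k' ] (YAt (prefix φ) y k' × k ≤ k')

  -- 𝓛_x for x of index k is generated by walking along these edges from x.
  Step : ℕ → ℕ → ℕ → Set
  Step k v w = (∃[ l ] (LitOf (matrix φ) l × VarInLit v l × VarInLit w l)) × YFrom k w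

  step? : ∀ k → Decidable (Step k)
  step? k v w = anyLit? (λ l → varInLit? v l ×-dec varInLit? w l) (matrix φ)
         ×-dec anyYAt? (k ≤?_) (prefix φ) w

  reach? : ∀ k → Decidable (Star (Step k))
  reach? k = FiniteReachability.star? ℕ._≟_ (step? k) (concatMap blockVars (prefix φ))
                                      (λ (_ , _ , yat , _) → idxAt-bound (inj₂ yat))

  Saturated : ℕ → ℕ → Set
  Saturated x v = ∀ {l} → LitOf (matrix φ) l → VarInLit v l → LX φ x l

  reach-saturated : ∀ {x k v} → XAt (prefix φ) x k → Star (Step k) x v → Saturated x v
  reach-saturated {x} {k} xat r = go r init
    where
    go : ∀ {u v} → Star (Step k) u v → Saturated x u → Saturated x v
    go ε sat = sat
    go (((l₀ , o₀ , u∈l₀ , w∈l₀) , k' , yat , k≤k') ◅ r) sat = go r λ o w∈l →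
      close (l₀ , sat o₀ u∈l₀ , w∈l₀) (k' , yat) (k , k' , inj₁ xat , inj₂ yat , k≤k')
            (o , _ , base (k' , yat) , w∈l)

  reach-target : ∀ {k x v} → Star (Step k) x v → v ≡ x ⊎ YFrom k v
  reach-target ε = inj₁ refl
  reach-target (s ◅ r) = inj₂ (last-late s r)
    where
    last-late : ∀ {k u w v} → Step k u w → Star (Step k) w v → YFrom k v
    last-late s ε = proj₂ s
    last-late _ (s ◅ r) = last-late s r

  Reaches : Atom → ℕ → ℕ → Set
  Reaches a x k = ∃[ v ] (VarInAtom v a × Star (Step k) x v)

  reaches-late : ∀ {a x k y} → AtomOf φ a → Reaches a x k → VarInAtom y a → YFrom k y →
                 Star (Step k) x y
  reaches-late (b , o) (w , w∈a , r) y∈a late = r ◅◅ (((b , _) , o , w∈a , y∈a) , late) ◅ ε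

  late-in-common-⊥ : ∀ {x k x' k' l y} → XAt (prefix φ) x k → XAt (prefix φ) x' k' →
                     x ≢ x' → k ≤ k' → LX φ x l → LX φ x' l → VarInLit y l → YFrom k y → ⊥
  late-in-common-⊥ {x} {k} {x'} {k'} {l} {y} xat x'at x≢x' k≤k' l∈𝓛ₓ l∈𝓛ₓ' y∈l (ky , yat , k≤ky) =
    condII x x' (k , xat) (k' , x'at) x≢x' (k , k' , inj₁ xat , inj₁ x'at , k≤k')
           y (ky , yat) (k , ky , inj₁ xat , inj₂ yat , k≤ky) ((l , l∈𝓛ₓ , y∈l) , (l , l∈𝓛ₓ' , y∈l))

  -- The two witnesses in the atom are either x and x' themselves, excluded by (I),
  -- or one of them is late for x, excluded by (II).
  reachers-ordered : ∀ {a x k x' k'} → AtomOf φ a → XAt (prefix φ) x k → Reaches a x k →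
                     XAt (prefix φ) x' k' → Reaches a x' k' → x ≢ x' → k ≤ k' → ⊥
  reachers-ordered {a} {x} {k} {x'} {k'} (b , o) xat (v , v∈a , r) x'at (w , w∈a , r') x≢x' k≤k'
    with reach-target r | reach-target r'
       | reach-saturated xat r o v∈a | reach-saturated x'at r' o w∈a
  ... | inj₂ v-late | _ | l∈𝓛ₓ | l∈𝓛ₓ' = late-in-common-⊥ xat x'at x≢x' k≤k' l∈𝓛ₓ l∈𝓛ₓ' v∈a v-late
  ... | inj₁ refl | inj₂ (kw , wat , k'≤kw) | l∈𝓛ₓ | l∈𝓛ₓ' =
    late-in-common-⊥ xat x'at x≢x' k≤k' l∈𝓛ₓ l∈𝓛ₓ' w∈a (kw , wat , ≤-trans k≤k' k'≤kw)
  ... | inj₁ refl | inj₁ refl | _ | _ = x≢x' (condI a (b , o) x x' v∈a w∈a (k , xat) (k' , x'at))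

  reacher-unique : ∀ {a x k x' k'} → AtomOf φ a → XAt (prefix φ) x k → Reaches a x k →
                   XAt (prefix φ) x' k' → Reaches a x' k' → x ≡ x'
  reacher-unique {x = x} {k} {x'} {k'} a∈At xat rx x'at rx' with x ℕ.≟ x' | ≤-total k k'
  ... | yes x≡x' | _ = x≡x'
  ... | no x≢x' | inj₁ k≤k' = ⊥-elim (reachers-ordered a∈At xat rx x'at rx' x≢x' k≤k')
  ... | no x≢x' | inj₂ k'≤k = ⊥-elim (reachers-ordered a∈At x'at rx' xat rx (x≢x' ∘ sym) k'≤k)

  owner? : ∀ a → Dec (∃[ x ] ∃[ k ] (XAt (prefix φ) x k × Reaches a x k))
  owner? a = anyXAt? (λ x k → anyVar? (reach? k x) (args a)) (prefix φ)

  label : Atom → Maybe ℕ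
  label a with owner? a
  ... | yes (x , _) = just x
  ... | no _ = nothing

  label-just : ∀ {a x} → label a ≡ just x → ∃[ k ] (XAt (prefix φ) x k × Reaches a x k)
  label-just {a} eq with owner? a | eq
  ... | yes (_ , k , xat , reaches) | refl = k , xat , reaches

  reaches⇒label : ∀ {a x k} → AtomOf φ a → XAt (prefix φ) x k → Reaches a x k → label a ≡ just x
  reaches⇒label {a} a∈At xat reaches
    with owner? a
  ... | yes (_ , _ , x'at , reaches') = cong just (reacher-unique a∈At x'at reaches' xat reaches)
  ... | no nobody = ⊥-elim (nobody (_ , _ , xat , reaches))

  labels : LabelsOK φ label
  labels a x _ eq = let k , xat , _ = label-just eq in k , xat

  condA : CondA φ label
  condA v (a , (a∈At , eq) , v∈a) (k , vat) =
    nothing≢just (trans (sym eq) (reaches⇒label a∈At vat (v , v∈a , ε)))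

  condB : CondB φ label
  condB x (k , xat) = x∈Atₓ , only-x
    where
    x∈Atₓ : VarsAtoms (At[_] φ label x) x
    x∈Atₓ with (b , a) , o , x∈a ← StandardForm.prefixUsed sf x (inj₁ (k , xat))
      = a , ((b , o) , reaches⇒label (b , o) xat (x , x∈a , ε)) , x∈a
    only-x : ∀ v → VarsAtoms (At[_] φ label x) v → IsX φ v → v ≡ x
    only-x v (a , (a∈At , eq) , v∈a) (kv , vat) =
      just-injective (trans (sym (reaches⇒label a∈At vat (v , v∈a , ε))) eq)

  condC : CondC φ label
  condC y (ky , yat) (x₀ , x₀∈x⃗ , y∈Atₓ₀@(a₀ , (a₀∈At , eq₀) , y∈a₀))
    with k₀ , x₀at , reaches₀ ← label-just eq₀
    with k₀ ≤? ky
  ... | yes k₀≤ky = inj₂ c2 , C1-C2-exclusive label y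
    where
    x₀→y : Star (Step k₀) x₀ y
    x₀→y = reaches-late a₀∈At reaches₀ y∈a₀ (ky , yat , k₀≤ky)
    labelled-x₀ : ∀ {a} → AtomOf φ a → VarInAtom y a → label a ≡ just x₀
    labelled-x₀ a∈At y∈a = reaches⇒label a∈At x₀at (y , y∈a , x₀→y)
    c2 : C2 φ label y
    c2 = x₀ , x₀∈x⃗ , y∈Atₓ₀
       , (λ { _ _ (_ , (a∈At , eq) , y∈a) → just-injective (trans (sym eq) (labelled-x₀ a∈At y∈a)) })
       , (λ { (_ , (a∈At , eq) , y∈a) → nothing≢just (trans (sym eq) (labelled-x₀ a∈At y∈a)) })
       , (k₀ , ky , inj₁ x₀at , inj₂ yat , k₀≤ky)
  ... | no k₀≰ky = inj₁ c1 , C1-C2-exclusive label y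
    where
    c1 : C1 φ label y
    c1 x _ (a , (a∈At , eq) , y∈a) with k , xat , reaches ← label-just eq with k ≤? ky
    ... | no k≰ky = ky , k , inj₂ yat , inj₁ xat , ≰⇒> k≰ky
    -- Otherwise x reaches y ∈ a₀, so x = x₀, whose index exceeds idx(y).
    ... | yes k≤ky
      with refl ← just-injective (trans (sym (reaches⇒label a₀∈At xat
                    (y , y∈a₀ , reaches-late a∈At reaches y∈a (ky , yat , k≤ky)))) eq₀)
      = ⊥-elim (k₀≰ky (subst (_≤ ky) (idx-unique (inj₁ xat) (inj₁ x₀at)) k≤ky))

  gaf : GAF φ
  gaf = label , labels , condA , condB , condC

lemma10 : (φ : Sentence) → StandardForm φ → (GAF φ ⇔ (CondI φ × CondII φ))
lemma10 φ sf = mk⇔ to from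
  where
  to : GAF φ → CondI φ × CondII φ
  to (f , labels , condA , condB , condC) = condI , condII
    where open GAF⇒Conditions φ sf f labels condA condB condC
  from : CondI φ × CondII φ → GAF φ
  from (condI , condII) = Conditions⇒GAF.gaf φ sf condI condII
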